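{- Let $N, M$ be coprime positive integers, $R$ a ring, $V$ an $R$-module with a left $\mathrm{Mat}_2(\mathbb{Z})_{\neq 0}$-action, and $n$ an integer with $(n,M)=1$. Define the $R[\mathrm{Mat}_2(\mathbb{Z})_{\neq0}]$-isomorphism $\mathrm{mult}_n: \mathcal{W}(M,V)\to\mathcal{W}(M,V)$, $f \mapsto \big((u,v)\mapsto f((nu,nv))\big)$, and denote also by $\mathrm{mult}_n$ the induced map on $H^1(\Gamma_1(N),\mathcal{W}(M,V))$. Then $$\langle n\rangle_M \circ \mathrm{Sh} = \mathrm{Sh}\circ \mathrm{mult}_n.$$
   Context: $\mathcal{W}(M,V) = \{f \in \mathrm{Hom}_R(R[(\mathbb{Z}/M\mathbb{Z})^2],V): f((u,v))=0$ whenever $\langle u,v\rangle\ne\mathbb{Z}/M\mathbb{Z}\}$ with left action $(g.f)((u,v)) = g.f((u,v)g)$. $\mathrm{Sh}: H^1(\Gamma_1(N),\mathcal{W}(M,V))\to H^1(\Gamma_1(NM),V)$ is the Shapiro isomorphism induced by $f\mapsto f((0,1))$. On $H^1(\Gamma_1(NM),V)$, $\langle n\rangle_M$ is the Hecke operator $T_\alpha$, $(T_\alpha c)(g) = \alpha^\iota.c(\alpha g\alpha^{ -1})$, for $\alpha \in \mathrm{SL}_2(\mathbb{Z})$ with $\alpha\equiv\mathrm{diag}(n^{ -1},n)$ mod $M$ and $\alpha\equiv 1$ mod $N$; here $\begin{pmatrix}a&b\\c&d\end{pmatrix}^\iota = \begin{pmatrix}d&-b\\-c&a\end{pmatrix}$.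 -}

module Defs where

open import Level using (Level; _⊔_)
open import Data.Integer using (ℤ; +_; _+_; _*_; -_; _-_; 0ℤ; 1ℤ)
open import Data.Nat using (ℕ)
open import Data.Product using (Σ; ∃; ∃-syntax; _×_; _,_; proj₁; proj₂)
open import Relation.Binary.PropositionalEquality using (_≡_)
open import Relation.Nullary using (¬_)
open import Algebra.Bundles using (Ring)
open import Algebra.Module.Bundles using (LeftModule)

record Mat2 : Set where
  constructor mat
  field
    a b c d : ℤ
open Mat2 public

infixl 7 _⊗_
_⊗_ : Mat2 → Mat2 → Mat2
mat a₁ b₁ c₁ d₁ ⊗ mat a₂ b₂ c₂ d₂ =
  mat (a₁ * a₂ + b₁ * c₂) (a₁ * b₂ + b₁ * d₂)
      (c₁ * a₂ + d₁ * c₂) (c₁ * b₂ + d₁ * d₂)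

I₂ : Mat2
I₂ = mat 1ℤ 0ℤ 0ℤ 1ℤ

det : Mat2 → ℤ
det (mat a b c d) = a * d - b * c

_ι : Mat2 → Mat2
mat a b c d ι = mat d (- b) (- c) a

rowMul : ℤ × ℤ → Mat2 → ℤ × ℤ
rowMul (u , v) (mat a b c d) = (u * a + v * c , u * b + v * d)

infix 4 _≡_[mod_]
_≡_[mod_] : ℤ → ℤ → ℕ → Set
x ≡ y [mod m ] = Σ ℤ λ k → x ≡ y + k * + m

SL2 : Mat2 → Set
SL2 g = det g ≡ 1ℤ

Γ₁ : ℕ → Mat2 → Set
Γ₁ N g = SL2 g × (a g ≡ 1ℤ [mod N ]) × (c g ≡ 0ℤ [mod N ]) × (d g ≡ 1ℤ [mod N ])

-- left action of Mat₂(ℤ)_{≠0} on an R-module V by R-linear maps.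
-- act is given on all of Mat₂(ℤ); the laws are required only for
-- matrices of nonzero determinant (values elsewhere are irrelevant).

_≢0 : ℤ → Set
z ≢0 = ¬ (z ≡ 0ℤ)

record MatAction {r ℓr m ℓm : Level} {R : Ring r ℓr} (V : LeftModule R m ℓm)
       : Set (r ⊔ ℓr ⊔ m ⊔ ℓm) where
  open Ring R using () renaming (Carrier to Rc)
  open LeftModule V
  field
    act      : Mat2 → Carrierᴹ → Carrierᴹ
    act-cong : ∀ g {x y} → det g ≢0 → x ≈ᴹ y → act g x ≈ᴹ act g y
    act-+    : ∀ g x y → det g ≢0 → act g (x +ᴹ y) ≈ᴹ act g x +ᴹ act g y
    act-*ₗ   : ∀ g (s : Rc) x → det g ≢0 → act g (s *ₗ x) ≈ᴹ s *ₗ act g x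
    act-id   : ∀ x → act I₂ x ≈ᴹ x
    act-⊗    : ∀ g h x → det g ≢0 → det h ≢0 →
               act (g ⊗ h) x ≈ᴹ act g (act h x)

module Coh {r ℓr m ℓm : Level} {R : Ring r ℓr} (V : LeftModule R m ℓm)
           (A : MatAction V) where
  open LeftModule V
  open MatAction A

  -- Hom_R(R[(ℤ/Mℤ)²], V) = maps (ℤ/Mℤ)² → V, represented as maps ℤ² → V
  -- that are M-periodic in each variable (see InW).
  Fn : Set m
  Fn = ℤ → ℤ → Carrierᴹ

  -- ⟨u , v⟩ = ℤ/Mℤ  (the subgroup generated by u, v mod M is everything)
  Generates : ℕ → ℤ → ℤ → Set
  Generates M u v = Σ ℤ λ x → Σ ℤ λ y → (x * u + y * v) ≡ 1ℤ [mod M ]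

  InW : ℕ → Fn → Set ℓm
  InW M f =
    (∀ u u′ v v′ → u ≡ u′ [mod M ] → v ≡ v′ [mod M ] → f u v ≈ᴹ f u′ v′)
    × (∀ u v → ¬ Generates M u v → f u v ≈ᴹ 0ᴹ)

  actW : Mat2 → Fn → Fn
  actW g f u v = act g (f (proj₁ (rowMul (u , v) g)) (proj₂ (rowMul (u , v) g)))

  -- 1-cocycles Γ₁(N) → 𝒲(M,V) (values outside Γ₁(N) are irrelevant)
  IsCocycleW : ℕ → ℕ → (Mat2 → Fn) → Set ℓm
  IsCocycleW N M c =
    (∀ g → Γ₁ N g → InW M (c g))
    × (∀ g h → Γ₁ N g → Γ₁ N h → ∀ u v →
         c (g ⊗ h) u v ≈ᴹ c g u v +ᴹ actW g (c h) u v)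

  -- two V-valued cochains on G define the same class in H¹(G,V):
  -- they differ by a coboundary  g ↦ g.x - x  on G
  Cohomologous : (Mat2 → Set) → (Mat2 → Carrierᴹ) → (Mat2 → Carrierᴹ) → Set (m ⊔ ℓm)
  Cohomologous G c c′ =
    ∃[ x ] (∀ g → G g → c g +ᴹ (-ᴹ c′ g) ≈ᴹ act g x +ᴹ (-ᴹ x))

  -- Shapiro map on cocycles: restrict to Γ₁(NM), evaluate at (0,1)
  Sh : (Mat2 → Fn) → (Mat2 → Carrierᴹ)
  Sh c g = c g 0ℤ 1ℤ

  multₙ : ℤ → (Mat2 → Fn) → (Mat2 → Fn)
  multₙ n c g u v = c g (n * u) (n * v)

  -- Hecke operator T_α : (T_α c)(g) = α^ι . c(α g α⁻¹)   (α ∈ SL₂, so α⁻¹ = α^ι)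
  T : Mat2 → (Mat2 → Carrierᴹ) → (Mat2 → Carrierᴹ)
  T α c g = act (α ι) (c (α ⊗ g ⊗ (α ι)))

DiamondMat : ℕ → ℕ → ℤ → Mat2 → Set
DiamondMat N M n α =
  SL2 α
  × (a α * n ≡ 1ℤ [mod M ]) × (b α ≡ 0ℤ [mod M ])
  × (c α ≡ 0ℤ [mod M ]) × (d α ≡ n [mod M ])
  × (a α ≡ 1ℤ [mod N ]) × (b α ≡ 0ℤ [mod N ])
  × (c α ≡ 0ℤ [mod N ]) × (d α ≡ 1ℤ [mod N ])

{-# OPTIONS --safe #-}
module Submission where

-- Write β = α^ι = α⁻¹ and s = (0,1)α ≡ (0,n) mod M.  For g ∈ Γ₁(NM) the cocycle rule splits
-- β.c(αgβ)((0,1)) into three terms: β.c(α)((0,1)) = -c(β)(s), because c(βα) = c(1) = 0;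
-- c(g)(s) = c(g)((0,n)) by M-periodicity; and g.c(β)(sg) = g.c(β)(s), because g fixes s mod M.
-- So T_α Sh c and Sh multₙ c differ by the coboundary of y = c(β)(s).

open import Defs

module Mat2Properties where
  open import Data.Integer using (_+_; _*_; -_; 0ℤ; 1ℤ)
  open import Data.Integer.Tactic.RingSolver using (solve-∀)
  open import Data.Product using (_,_)
  open import Relation.Binary.PropositionalEquality using (_≡_; refl; sym; trans; cong; cong₂; module ≡-Reasoning)

  mat-cong : ∀ {a b c d a′ b′ c′ d′} → a ≡ a′ → b ≡ b′ → c ≡ c′ → d ≡ d′ →
             mat a b c d ≡ mat a′ b′ c′ d′
  mat-cong refl refl refl refl = refl

  det-⊗ : ∀ g h → det (g ⊗ h) ≡ det g * det h
  det-⊗ (mat a b c d) (mat a′ b′ c′ d′) = expand a b c d a′ b′ c′ d′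
    where
    expand : ∀ a b c d a′ b′ c′ d′ →
      (a * a′ + b * c′) * (c * b′ + d * d′) + - ((a * b′ + b * d′) * (c * a′ + d * c′))
      ≡ (a * d + - (b * c)) * (a′ * d′ + - (b′ * c′))
    expand = solve-∀

  det-ι : ∀ g → det (g ι) ≡ det g
  det-ι (mat a b c d) = expand a b c d
    where
    expand : ∀ a b c d → d * a + - ((- b) * (- c)) ≡ a * d + - (b * c)
    expand = solve-∀

  SL2-⊗ : ∀ g h → SL2 g → SL2 h → SL2 (g ⊗ h)
  SL2-⊗ g h det-g det-h = trans (det-⊗ g h) (cong₂ _*_ det-g det-h)

  SL2-ι : ∀ g → SL2 g → SL2 (g ι)
  SL2-ι g det-g = trans (det-ι g) det-g

  SL2⇒det≢0 : ∀ g → SL2 g → det g ≢0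
  SL2⇒det≢0 _ det≡1 det≡0 with trans (sym det≡1) det≡0
  ... | ()

  ι-inverseˡ : ∀ g → SL2 g → g ι ⊗ g ≡ I₂
  ι-inverseˡ (mat a b c d) det≡1 =
    mat-cong (trans (diagonal a b c d) det≡1) (upper a b c d)
             (lower a b c d) (trans (diagonal′ a b c d) det≡1)
    where
    diagonal : ∀ a b c d → d * a + (- b) * c ≡ a * d + - (b * c)
    diagonal = solve-∀
    upper : ∀ a b c d → d * b + (- b) * d ≡ 0ℤ
    upper = solve-∀
    lower : ∀ a b c d → (- c) * a + a * c ≡ 0ℤ
    lower = solve-∀
    diagonal′ : ∀ a b c d → (- c) * b + a * d ≡ a * d + - (b * c)
    diagonal′ = solve-∀

  ι-inverseʳ : ∀ g → SL2 g → g ⊗ g ι ≡ I₂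
  ι-inverseʳ (mat a b c d) det≡1 =
    mat-cong (trans (diagonal a b c d) det≡1) (upper a b c d)
             (lower a b c d) (trans (diagonal′ a b c d) det≡1)
    where
    diagonal : ∀ a b c d → a * d + b * (- c) ≡ a * d + - (b * c)
    diagonal = solve-∀
    upper : ∀ a b c d → a * (- b) + b * a ≡ 0ℤ
    upper = solve-∀
    lower : ∀ a b c d → c * d + d * (- c) ≡ 0ℤ
    lower = solve-∀
    diagonal′ : ∀ a b c d → c * (- b) + d * a ≡ a * d + - (b * c)
    diagonal′ = solve-∀

  rowMul-identityʳ : ∀ x → rowMul x I₂ ≡ x
  rowMul-identityʳ (u , v) = cong₂ _,_ (first u v) (second u v)
    where
    first : ∀ u v → u * 1ℤ + v * 0ℤ ≡ u
    first = solve-∀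
    second : ∀ u v → u * 0ℤ + v * 1ℤ ≡ v
    second = solve-∀

  rowMul-⊗ : ∀ x g h → rowMul (rowMul x g) h ≡ rowMul x (g ⊗ h)
  rowMul-⊗ (u , v) (mat a b c d) (mat a′ b′ c′ d′) =
    cong₂ _,_ (entry u v a b c d a′ c′) (entry u v a b c d b′ d′)
    where
    entry : ∀ u v a b c d p q →
      (u * a + v * c) * p + (u * b + v * d) * q ≡ u * (a * p + b * q) + v * (c * p + d * q)
    entry = solve-∀

  rowMul-ι-cancelʳ : ∀ x g → SL2 g → rowMul (rowMul x g) (g ι) ≡ x
  rowMul-ι-cancelʳ x g det≡1 = begin
    rowMul (rowMul x g) (g ι) ≡⟨ rowMul-⊗ x g (g ι) ⟩
    rowMul x (g ⊗ g ι)        ≡⟨ cong (rowMul x) (ι-inverseʳ g det≡1) ⟩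
    rowMul x I₂               ≡⟨ rowMul-identityʳ x ⟩
    x                         ∎
    where open ≡-Reasoning

module CongruenceSubgroups where
  open import Data.Nat using (ℕ)
  import Data.Nat as ℕ
  open import Data.Integer using (ℤ; +_; _+_; _*_; -_; 0ℤ; 1ℤ)
  open import Data.Integer.Properties using (pos-*)
  open import Data.Integer.Tactic.RingSolver using (solve-∀)
  open import Data.Product using (_×_; _,_)
  open import Relation.Binary.PropositionalEquality using (_≡_; refl; trans; cong)
  open Mat2Properties using (SL2-⊗; SL2-ι)

  infix 4 _≡₂_[mod_]
  _≡₂_[mod_] : ℤ × ℤ → ℤ × ℤ → ℕ → Set
  (u , v) ≡₂ (u′ , v′) [mod m ] = u ≡ u′ [mod m ] × v ≡ v′ [mod m ]

  mod-*⇒modˡ : ∀ N M {x y} → x ≡ y [mod N ℕ.* M ] → x ≡ y [mod N ]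
  mod-*⇒modˡ N M {y = y} (k , refl) =
    k * + M , cong (_+_ y) (trans (cong (k *_) (pos-* N M)) (reorder k (+ N) (+ M)))
    where
    reorder : ∀ k n m → k * (n * m) ≡ (k * m) * n
    reorder = solve-∀

  mod-*⇒modʳ : ∀ N M {x y} → x ≡ y [mod N ℕ.* M ] → x ≡ y [mod M ]
  mod-*⇒modʳ N M {y = y} (k , refl) =
    k * + N , cong (_+_ y) (trans (cong (k *_) (pos-* N M)) (reorder k (+ N) (+ M)))
    where
    reorder : ∀ k n m → k * (n * m) ≡ (k * n) * m
    reorder = solve-∀

  Γ₁-*⇒Γ₁ˡ : ∀ N M g → Γ₁ (N ℕ.* M) g → Γ₁ N g
  Γ₁-*⇒Γ₁ˡ N M _ (det≡1 , a≡1 , c≡0 , d≡1) =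
    det≡1 , mod-*⇒modˡ N M {y = 1ℤ} a≡1 , mod-*⇒modˡ N M {y = 0ℤ} c≡0
    , mod-*⇒modˡ N M {y = 1ℤ} d≡1

  Γ₁-*⇒Γ₁ʳ : ∀ N M g → Γ₁ (N ℕ.* M) g → Γ₁ M g
  Γ₁-*⇒Γ₁ʳ N M _ (det≡1 , a≡1 , c≡0 , d≡1) =
    det≡1 , mod-*⇒modʳ N M {y = 1ℤ} a≡1 , mod-*⇒modʳ N M {y = 0ℤ} c≡0
    , mod-*⇒modʳ N M {y = 1ℤ} d≡1

  Γ₁-I₂ : ∀ {N} → Γ₁ N I₂
  Γ₁-I₂ = refl , (0ℤ , refl) , (0ℤ , refl) , (0ℤ , refl)

  Γ₁-⊗ : ∀ {N} g h → Γ₁ N g → Γ₁ N h → Γ₁ N (g ⊗ h)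
  Γ₁-⊗ {N} g@(mat _ b _ _) h@(mat _ b′ _ _)
    (det-g , (k₁ , refl) , (k₃ , refl) , (k₄ , refl))
    (det-h , (l₁ , refl) , (l₃ , refl) , (l₄ , refl)) =
    SL2-⊗ g h det-g det-h
    , (k₁ + l₁ + k₁ * l₁ * + N + b * l₃ , a-entry k₁ l₁ b l₃ (+ N))
    , (k₃ * (1ℤ + l₁ * + N) + (1ℤ + k₄ * + N) * l₃ , c-entry k₃ l₁ k₄ l₃ (+ N))
    , (k₃ * b′ + k₄ + l₄ + k₄ * l₄ * + N , d-entry k₃ b′ k₄ l₄ (+ N))
    where
    a-entry : ∀ k₁ l₁ b l₃ p → (1ℤ + k₁ * p) * (1ℤ + l₁ * p) + b * (0ℤ + l₃ * p)
              ≡ 1ℤ + (k₁ + l₁ + k₁ * l₁ * p + b * l₃) * p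
    a-entry = solve-∀
    c-entry : ∀ k₃ l₁ k₄ l₃ p → (0ℤ + k₃ * p) * (1ℤ + l₁ * p) + (1ℤ + k₄ * p) * (0ℤ + l₃ * p)
              ≡ 0ℤ + (k₃ * (1ℤ + l₁ * p) + (1ℤ + k₄ * p) * l₃) * p
    c-entry = solve-∀
    d-entry : ∀ k₃ b′ k₄ l₄ p → (0ℤ + k₃ * p) * b′ + (1ℤ + k₄ * p) * (1ℤ + l₄ * p)
              ≡ 1ℤ + (k₃ * b′ + k₄ + l₄ + k₄ * l₄ * p) * p
    d-entry = solve-∀

  Γ₁-ι : ∀ {N} g → Γ₁ N g → Γ₁ N (g ι)
  Γ₁-ι {N} g (det≡1 , a≡1 , (k , refl) , d≡1) =
    SL2-ι g det≡1 , d≡1 , (- k , negate k (+ N)) , a≡1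
    where
    negate : ∀ k p → - (0ℤ + k * p) ≡ 0ℤ + (- k) * p
    negate = solve-∀

  DiamondMat⇒Γ₁ : ∀ {N M n} α → DiamondMat N M n α → Γ₁ N α
  DiamondMat⇒Γ₁ _ (det≡1 , _ , _ , _ , _ , a≡1 , _ , c≡0 , d≡1) = det≡1 , a≡1 , c≡0 , d≡1

  bottomRow-≡₂ : ∀ {M} g n → c g ≡ 0ℤ [mod M ] → d g ≡ n [mod M ] →
                 rowMul (0ℤ , 1ℤ) g ≡₂ (0ℤ , n) [mod M ]
  bottomRow-≡₂ {M} (mat a b _ _) n (j , refl) (j′ , refl) =
    (j , first a j (+ M)) , (j′ , second b n j′ (+ M))
    where
    first : ∀ a j p → 0ℤ * a + 1ℤ * (0ℤ + j * p) ≡ 0ℤ + j * p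
    first = solve-∀
    second : ∀ b n j′ p → 0ℤ * b + 1ℤ * (n + j′ * p) ≡ n + j′ * p
    second = solve-∀

  DiamondMat⇒bottomRow≡₂ : ∀ {N M n} α → DiamondMat N M n α →
                           rowMul (0ℤ , 1ℤ) α ≡₂ (0ℤ , n) [mod M ]
  DiamondMat⇒bottomRow≡₂ {n = n} α (_ , _ , _ , c≡0 , d≡n , _) = bottomRow-≡₂ α n c≡0 d≡n

  rowMul-Γ₁ : ∀ {M g} u v → Γ₁ M g → u ≡ 0ℤ [mod M ] → rowMul (u , v) g ≡₂ (u , v) [mod M ]
  rowMul-Γ₁ {M} {mat _ b _ _} _ v (_ , (k₁ , refl) , (k₃ , refl) , (k₄ , refl)) (j , refl) =
    (u * k₁ + v * k₃ , first u k₁ v k₃ (+ M)) , (j * b + v * k₄ , second j b v k₄ (+ M))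
    where
    u = 0ℤ + j * + M
    first : ∀ u k₁ v k₃ p → u * (1ℤ + k₁ * p) + v * (0ℤ + k₃ * p) ≡ u + (u * k₁ + v * k₃) * p
    first = solve-∀
    second : ∀ j b v k₄ p → (0ℤ + j * p) * b + v * (1ℤ + k₄ * p) ≡ v + (j * b + v * k₄) * p
    second = solve-∀

open import Data.Nat using (ℕ; _<_; _*_)
open import Data.Nat.Coprimality using (Coprime)
open import Data.Integer using (ℤ; ∣_∣; 0ℤ; 1ℤ)
open import Data.Integer.Properties using (*-zeroʳ; *-identityʳ)
open import Data.Product using (_×_; _,_; proj₁; proj₂; uncurry)
open import Algebra.Bundles using (Ring; AbelianGroup)
open import Algebra.Module.Bundles using (LeftModule)
import Algebra.Properties.AbelianGroup as AbelianGroupProperties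
open import Relation.Binary.PropositionalEquality using (cong; cong₂; subst)
import Relation.Binary.Reasoning.Setoid as SetoidReasoning
open Mat2Properties
open CongruenceSubgroups

x⁻¹yzy⁻¹≈zx⁻¹ : ∀ {a ℓ} (G : AbelianGroup a ℓ) → let open AbelianGroup G in
                ∀ x y z → x ⁻¹ ∙ y ∙ z ∙ y ⁻¹ ≈ z ∙ x ⁻¹
x⁻¹yzy⁻¹≈zx⁻¹ G x y z = begin
  x ⁻¹ ∙ y ∙ z ∙ y ⁻¹    ≈⟨ ∙-congʳ (∙-congʳ (comm _ _)) ⟩
  y ∙ x ⁻¹ ∙ z ∙ y ⁻¹    ≈⟨ ∙-congʳ (assoc _ _ _) ⟩
  y ∙ (x ⁻¹ ∙ z) ∙ y ⁻¹  ≈⟨ xyx⁻¹≈y y _ ⟩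
  x ⁻¹ ∙ z               ≈⟨ comm _ _ ⟩
  z ∙ x ⁻¹               ∎
  where
  open AbelianGroup G
  open AbelianGroupProperties G using (xyx⁻¹≈y)
  open SetoidReasoning setoid

module Cocycles {r ℓr m ℓm} {R : Ring r ℓr} (V : LeftModule R m ℓm) (A : MatAction V) where
  open LeftModule V
  open MatAction A
  open Coh V A
  open AbelianGroupProperties +ᴹ-abelianGroup using (identityˡ-unique; inverseʳ-unique)
  open SetoidReasoning ≈ᴹ-setoid

  act-ι-cancelˡ : ∀ g → SL2 g → ∀ x → act (g ι) (act g x) ≈ᴹ x
  act-ι-cancelˡ g det≡1 x = begin
    act (g ι) (act g x)  ≈⟨ act-⊗ (g ι) g x (SL2⇒det≢0 (g ι) (SL2-ι g det≡1)) (SL2⇒det≢0 g det≡1) ⟨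
    act (g ι ⊗ g) x      ≡⟨ cong (λ h → act h x) (ι-inverseˡ g det≡1) ⟩
    act I₂ x             ≈⟨ act-id x ⟩
    x                    ∎

  module Cocycle {N M : ℕ} (c : Mat2 → Fn) (c-cocycle : IsCocycleW N M c) where

    c-periodic : ∀ {g} → Γ₁ N g → ∀ {x y} → x ≡₂ y [mod M ] →
                 uncurry (c g) x ≈ᴹ uncurry (c g) y
    c-periodic g∈Γ₁ {u , v} {u′ , v′} (u≡u′ , v≡v′) =
      proj₁ (proj₁ c-cocycle _ g∈Γ₁) u u′ v v′ u≡u′ v≡v′

    c-⊗ : ∀ {g h} → Γ₁ N g → Γ₁ N h → ∀ x →
          uncurry (c (g ⊗ h)) x ≈ᴹ uncurry (c g) x +ᴹ act g (uncurry (c h) (rowMul x g))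
    c-⊗ g∈Γ₁ h∈Γ₁ (u , v) = proj₂ c-cocycle _ _ g∈Γ₁ h∈Γ₁ u v

    c-I₂ : ∀ x → uncurry (c I₂) x ≈ᴹ 0ᴹ
    -- I₂ ⊗ I₂ computes to I₂, so the cocycle rule at (I₂, I₂) says c I₂ = c I₂ + c I₂.
    c-I₂ x = identityˡ-unique _ _ (≈ᴹ-sym (begin
      uncurry (c I₂) x
        ≈⟨ c-⊗ Γ₁-I₂ Γ₁-I₂ x ⟩
      uncurry (c I₂) x +ᴹ act I₂ (uncurry (c I₂) (rowMul x I₂))
        ≈⟨ +ᴹ-congˡ (act-id _) ⟩
      uncurry (c I₂) x +ᴹ uncurry (c I₂) (rowMul x I₂)
        ≈⟨ +ᴹ-congˡ (≈ᴹ-reflexive (cong (uncurry (c I₂)) (rowMul-identityʳ x))) ⟩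
      uncurry (c I₂) x +ᴹ uncurry (c I₂) x
        ∎))

    c-ι : ∀ {g} → Γ₁ N g → ∀ x →
          act (g ι) (uncurry (c g) (rowMul x (g ι))) ≈ᴹ -ᴹ uncurry (c (g ι)) x
    c-ι {g} g∈Γ₁ x = inverseʳ-unique _ _ (begin
      uncurry (c (g ι)) x +ᴹ act (g ι) (uncurry (c g) (rowMul x (g ι)))
        ≈⟨ c-⊗ (Γ₁-ι g g∈Γ₁) g∈Γ₁ x ⟨
      uncurry (c (g ι ⊗ g)) x
        ≡⟨ cong (λ h → uncurry (c h) x) (ι-inverseˡ g (proj₁ g∈Γ₁)) ⟩
      uncurry (c I₂) x
        ≈⟨ c-I₂ x ⟩
      0ᴹ
        ∎)

    module Diamond {n : ℤ} {α : Mat2} (α-diamond : DiamondMat N M n α) where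
      private
        det-α : SL2 α
        det-α = proj₁ α-diamond
        α∈Γ₁ : Γ₁ N α
        α∈Γ₁ = DiamondMat⇒Γ₁ α α-diamond
        β : Mat2
        β = α ι
        β∈Γ₁ : Γ₁ N β
        β∈Γ₁ = Γ₁-ι α α∈Γ₁
        det-β≢0 : det β ≢0
        det-β≢0 = SL2⇒det≢0 β (proj₁ β∈Γ₁)
        s : ℤ × ℤ
        s = rowMul (0ℤ , 1ℤ) α
        s≡₂0n : s ≡₂ (0ℤ , n) [mod M ]
        s≡₂0n = DiamondMat⇒bottomRow≡₂ α α-diamond

      y : Carrierᴹ
      y = uncurry (c β) s

      T-Sh-≈ : ∀ {g} → Γ₁ (N * M) g → T α (Sh c) g ≈ᴹ -ᴹ y +ᴹ Sh (multₙ n c) g +ᴹ act g y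
      T-Sh-≈ {g} g∈Γ₁NM = begin
        act β (c (α ⊗ g ⊗ β) 0ℤ 1ℤ)
          ≈⟨ act-cong β det-β≢0 (c-⊗ αg∈Γ₁ β∈Γ₁ (0ℤ , 1ℤ)) ⟩
        act β (c (α ⊗ g) 0ℤ 1ℤ +ᴹ act (α ⊗ g) z)
          ≈⟨ act-cong β det-β≢0 (+ᴹ-congʳ (c-⊗ α∈Γ₁ g∈Γ₁N (0ℤ , 1ℤ))) ⟩
        act β (c α 0ℤ 1ℤ +ᴹ act α (uncurry (c g) s) +ᴹ act (α ⊗ g) z)
          ≈⟨ act-+ β _ _ det-β≢0 ⟩
        act β (c α 0ℤ 1ℤ +ᴹ act α (uncurry (c g) s)) +ᴹ act β (act (α ⊗ g) z)
          ≈⟨ +ᴹ-congʳ (act-+ β _ _ det-β≢0) ⟩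
        act β (c α 0ℤ 1ℤ) +ᴹ act β (act α (uncurry (c g) s)) +ᴹ act β (act (α ⊗ g) z)
          ≈⟨ +ᴹ-cong (+ᴹ-cong β·cα≈-y β·α·cg≈Sh-multₙ) β·αg·cβ≈g·y ⟩
        -ᴹ y +ᴹ Sh (multₙ n c) g +ᴹ act g y
          ∎
        where
        g∈Γ₁N : Γ₁ N g
        g∈Γ₁N = Γ₁-*⇒Γ₁ˡ N M g g∈Γ₁NM
        g∈Γ₁M : Γ₁ M g
        g∈Γ₁M = Γ₁-*⇒Γ₁ʳ N M g g∈Γ₁NM
        det-g≢0 : det g ≢0
        det-g≢0 = SL2⇒det≢0 g (proj₁ g∈Γ₁N)
        αg∈Γ₁ : Γ₁ N (α ⊗ g)
        αg∈Γ₁ = Γ₁-⊗ α g α∈Γ₁ g∈Γ₁N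
        z : Carrierᴹ
        z = uncurry (c β) (rowMul (0ℤ , 1ℤ) (α ⊗ g))

        β·cα≈-y : act β (c α 0ℤ 1ℤ) ≈ᴹ -ᴹ y
        β·cα≈-y = begin
          act β (c α 0ℤ 1ℤ)
            ≡⟨ cong (λ x → act β (uncurry (c α) x)) (rowMul-ι-cancelʳ (0ℤ , 1ℤ) α det-α) ⟨
          act β (uncurry (c α) (rowMul s β))
            ≈⟨ c-ι α∈Γ₁ s ⟩
          -ᴹ y
            ∎

        β·α·cg≈Sh-multₙ : act β (act α (uncurry (c g) s)) ≈ᴹ Sh (multₙ n c) g
        β·α·cg≈Sh-multₙ = begin
          act β (act α (uncurry (c g) s))  ≈⟨ act-ι-cancelˡ α det-α _ ⟩
          uncurry (c g) s                  ≈⟨ c-periodic g∈Γ₁N s≡₂0n ⟩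
          c g 0ℤ n                         ≡⟨ cong₂ (c g) (*-zeroʳ n) (*-identityʳ n) ⟨
          Sh (multₙ n c) g                 ∎

        αg-row≡₂s : rowMul (0ℤ , 1ℤ) (α ⊗ g) ≡₂ s [mod M ]
        αg-row≡₂s = subst (λ x → x ≡₂ s [mod M ]) (rowMul-⊗ (0ℤ , 1ℤ) α g)
                          (rowMul-Γ₁ (proj₁ s) (proj₂ s) g∈Γ₁M (proj₁ s≡₂0n))

        β·αg·cβ≈g·y : act β (act (α ⊗ g) z) ≈ᴹ act g y
        β·αg·cβ≈g·y = begin
          act β (act (α ⊗ g) z)    ≈⟨ act-cong β det-β≢0 (act-⊗ α g z (SL2⇒det≢0 α det-α) det-g≢0) ⟩
          act β (act α (act g z))  ≈⟨ act-ι-cancelˡ α det-α _ ⟩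
          act g z                  ≈⟨ act-cong g det-g≢0 (c-periodic β∈Γ₁ αg-row≡₂s) ⟩
          act g y                  ∎

-- Positivity and coprimality are what make Sh and multₙ isomorphisms; the identity holds without them.
proposition3p5 : ∀ {r ℓr m ℓm} (N M : ℕ) → 0 < N → 0 < M → Coprime N M →
    (R : Ring r ℓr) (V : LeftModule R m ℓm) (A : MatAction V) →
    (n : ℤ) → Coprime ∣ n ∣ M →
    (α : Mat2) → DiamondMat N M n α →
    (c : Mat2 → Coh.Fn V A) → Coh.IsCocycleW V A N M c →
    Coh.Cohomologous V A (Γ₁ (N * M))
      (Coh.T V A α (Coh.Sh V A c)) (Coh.Sh V A (Coh.multₙ V A n c))
proposition3p5 N M _ _ _ R V A n _ α α-diamond c c-cocycle =
  y , λ g g∈Γ₁NM → ≈ᴹ-trans (+ᴹ-congʳ (T-Sh-≈ g∈Γ₁NM)) (x⁻¹yzy⁻¹≈zx⁻¹ +ᴹ-abelianGroup y _ _)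
  where
  open LeftModule V using (≈ᴹ-trans; +ᴹ-congʳ; +ᴹ-abelianGroup)
  open Cocycles.Cocycle.Diamond V A c c-cocycle α-diamond
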